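{- Let $k \geq 1$ be an integer, and let $T_k$ be a tournament with $\vec{\omega}(T_k) = k$ for which there is a tournament $T$ with $\vec{\omega}(T) = k$ such that for every $X \subseteq V(T_k)$, $T_k[X]$ or $T_k[V(T_k)\setminus X]$ contains a copy of $T$. Let $D$ be a digraph, let $u, v \in V(D)$, and let $W \subseteq N^+(u) \cap N^-(v)$ be such that $D[W]$ is isomorphic to $T_k$. If $\prec$ is a total order of $V(D)$ with $\omega(D^{\prec}) \leq k$, then $u \prec v$.
   Context: A tournament is an orientation of a complete graph. For a digraph $D$ and a total order $\prec$ on $V(D)$, the backedge graph $D^{\prec}$ is the undirected graph on $V(D)$ in which $x,y$ with $x \prec y$ are adjacent if and only if $yx \in A(D)$. For a tournament $T$, $\vec{\omega}(T) = \min_{\prec} \omega(T^{\prec})$ over all total orders $\prec$ of $V(T)$. $N^+(u)$ is the set of out-neighbours of $u$ and $N^-(v)$ the set of in-neighbours of $v$. A copy of $T$ is a subtournament isomorphic to $T$. -}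

module Defs where

open import Level using (0ℓ)
open import Data.Nat using (ℕ; _≤_)
open import Data.Bool using (Bool; T)
open import Data.Fin using (Fin)
open import Data.Fin.Subset using (Subset; _∈_; _∉_; ∣_∣)
open import Data.Product using (Σ; _×_; ∃)
open import Relation.Binary.Core using (Rel)
open import Relation.Binary.Structures using (IsStrictTotalOrder)
open import Relation.Binary.PropositionalEquality using (_≡_; _≢_)
open import Relation.Nullary using (¬_)
open import Function.Definitions using (Injective)

Digraph : ℕ → Set
Digraph n = Fin n → Fin n → Bool

arc : ∀ {n} → Digraph n → Fin n → Fin n → Set
arc D x y = T (D x y)

record IsTournament {n : ℕ} (D : Digraph n) : Set where
  field
    loopless   : ∀ x → ¬ arc D x x
    total      : ∀ x y → x ≢ y → D x y ≡ Data.Bool.not (D y x)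

TotalOrder : ℕ → Set₁
TotalOrder n = Σ (Rel (Fin n) 0ℓ) λ _≺_ → IsStrictTotalOrder _≡_ _≺_

-- S is a clique of the backedge graph D^≺:
-- for x ≺ y in S, x and y are adjacent in D^≺, i.e. yx ∈ A(D).
IsBackClique : ∀ {n} → Digraph n → Rel (Fin n) 0ℓ → Subset n → Set
IsBackClique D _≺_ S = ∀ x y → x ∈ S → y ∈ S → x ≺ y → arc D y x

ωBack≤ : ∀ {n} → Digraph n → Rel (Fin n) 0ℓ → ℕ → Set
ωBack≤ {n} D _≺_ k = (S : Subset n) → IsBackClique D _≺_ S → ∣ S ∣ ≤ k

ωBack≥ : ∀ {n} → Digraph n → Rel (Fin n) 0ℓ → ℕ → Set
ωBack≥ {n} D _≺_ k = Σ (Subset n) λ S → IsBackClique D _≺_ S × (k ≤ ∣ S ∣)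

-- ω⃗(D) = min over total orders ≺ of ω(D^≺) equals k:
-- some order attains ω ≤ k, and every order has ω ≥ k.
ω⃗≡ : ∀ {n} → Digraph n → ℕ → Set₁
ω⃗≡ {n} D k =
  (Σ (TotalOrder n) λ o → ωBack≤ D (Data.Product.proj₁ o) k)
  × ((o : TotalOrder n) → ωBack≥ D (Data.Product.proj₁ o) k)

HasCopyIn : ∀ {m p} → Digraph m → Subset m → Digraph p → Set
HasCopyIn {m} {p} G X H =
  Σ (Fin p → Fin m) λ g → Injective _≡_ _≡_ g × (∀ i → g i ∈ X)
    × (∀ i j → G (g i) (g j) ≡ H i j)

-- Suppose v ⪯ u. Split W according to whether a vertex lies before u; one side
-- contains a copy of T. A copy before u is entirely back-adjacent to u (all its
-- vertices are out-neighbours of u), and a copy not before u lies after v and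
-- is entirely back-adjacent to v (all its vertices are in-neighbours of v).
-- Every order of the copy has a backedge clique of size k since ω⃗(T) = k, and
-- adding u resp. v yields a clique of size k + 1 in D^≺.
module Submission where

open import Defs
open import Level using (0ℓ)
open import Data.Nat using (ℕ; suc; _≤_; z≤n; s≤s)
open import Data.Nat.Properties using (≤-trans; 1+n≰n)
open import Data.Bool using (T)
open import Data.Bool.Properties using (T-≡)
open import Data.Fin using (Fin; zero; suc; _≟_)
open import Data.Fin.Properties using (any?; suc-injective; 0≢1+n)
open import Data.Fin.Subset using (Subset; ∁; _∈_; ∣_∣; _-_; inside; outside)
open import Data.Fin.Subset.Properties using (_∈?_; x∈p∧x≢y⇒x∈p-y; x∈p⇒∣p-x∣<∣p∣; x∈∁p⇒x∉p)
open import Data.Vec using ([]; _∷_; here; there; tabulate)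
open import Data.Vec.Properties using (lookup∘tabulate; []=⇒lookup; lookup⇒[]=)
open import Data.Vec.Functional using () renaming (_∷_ to _◂_)
open import Data.Product using (Σ; ∃; _×_; _,_; proj₁; proj₂)
open import Data.Sum using (_⊎_; inj₁; inj₂; swap)
open import Data.Empty using (⊥-elim)
open import Function using (_∘_; Equivalence)
open import Function.Definitions using (Injective)
open import Relation.Nullary using (¬_)
open import Relation.Nullary.Decidable using (isYes; toWitness; fromWitness; _×-dec_)
open import Relation.Unary using (Pred; Decidable)
open import Relation.Binary.Core using (Rel)
open import Relation.Binary.Definitions using (Tri; tri<; tri≈; tri>)
open import Relation.Binary.Structures using (IsStrictTotalOrder)
import Relation.Binary.Construct.StrictToNonStrict as StrictToNonStrict
open import Relation.Binary.PropositionalEquality using (_≡_; _≢_; refl; sym; trans; cong; subst; resp₂; isEquivalence)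

private
  variable
    m n p : ℕ

decSubset : {P : Pred (Fin n) 0ℓ} → Decidable P → Subset n
decSubset P? = tabulate (isYes ∘ P?)

module _ {P : Pred (Fin n) 0ℓ} (P? : Decidable P) where

  ∈-decSubset⁺ : ∀ {x} → P x → x ∈ decSubset P?
  ∈-decSubset⁺ {x} px = lookup⇒[]= x _
    (trans (lookup∘tabulate _ x) (Equivalence.to T-≡ (fromWitness {a? = P? x} px)))

  ∈-decSubset⁻ : ∀ {x} → x ∈ decSubset P? → P x
  ∈-decSubset⁻ {x} x∈ = toWitness {a? = P? x}
    (Equivalence.from T-≡ (trans (sym (lookup∘tabulate _ x)) ([]=⇒lookup x∈)))

image : (Fin p → Fin n) → Subset p → Subset n
image h S = decSubset (λ x → any? (λ i → (i ∈? S) ×-dec (h i ≟ x)))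

module _ (h : Fin p → Fin n) (S : Subset p) where

  ∈-image⁺ : ∀ {i} → i ∈ S → h i ∈ image h S
  ∈-image⁺ {i} i∈S = ∈-decSubset⁺ _ (i , i∈S , refl)

  ∈-image⁻ : ∀ {x} → x ∈ image h S → ∃ λ i → i ∈ S × h i ≡ x
  ∈-image⁻ = ∈-decSubset⁻ _

∣p∣≤∣q∣-injection : {h : Fin p → Fin n} → Injective _≡_ _≡_ h →
                    (S : Subset p) (B : Subset n) → (∀ {i} → i ∈ S → h i ∈ B) →
                    ∣ S ∣ ≤ ∣ B ∣
∣p∣≤∣q∣-injection h-inj [] B h[S]⊆B = z≤n
∣p∣≤∣q∣-injection h-inj (outside ∷ S) B h[S]⊆B =
  ∣p∣≤∣q∣-injection (suc-injective ∘ h-inj) S B (h[S]⊆B ∘ there)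
∣p∣≤∣q∣-injection {h = h} h-inj (inside ∷ S) B h[S]⊆B =
  ≤-trans (s≤s (∣p∣≤∣q∣-injection (suc-injective ∘ h-inj) S (B - h zero) h[S]⊆B-h₀))
          (x∈p⇒∣p-x∣<∣p∣ (h[S]⊆B here))
  where
  h[S]⊆B-h₀ : ∀ {i} → i ∈ S → h (suc i) ∈ B - h zero
  h[S]⊆B-h₀ i∈S = x∈p∧x≢y⇒x∈p-y (h[S]⊆B (there i∈S)) (0≢1+n ∘ h-inj ∘ sym)

∣p∣≤∣image∣ : {h : Fin p → Fin n} → Injective _≡_ _≡_ h → (S : Subset p) → ∣ S ∣ ≤ ∣ image h S ∣
∣p∣≤∣image∣ {h = h} h-inj S = ∣p∣≤∣q∣-injection h-inj S (image h S) (∈-image⁺ h S)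

◂-injective : ∀ {z} {h : Fin p → Fin n} → (∀ i → z ≢ h i) → Injective _≡_ _≡_ h →
              Injective _≡_ _≡_ (z ◂ h)
◂-injective _    _     {zero}  {zero}  _  = refl
◂-injective z∉h  _     {zero}  {suc j} eq = ⊥-elim (z∉h j eq)
◂-injective z∉h  _     {suc i} {zero}  eq = ⊥-elim (z∉h i (sym eq))
◂-injective _    h-inj {suc i} {suc j} eq = cong suc (h-inj eq)

record IsEmbedding (H : Digraph p) (G : Digraph n) (h : Fin p → Fin n) : Set where
  constructor _,_
  field
    injective : Injective _≡_ _≡_ h
    arcs      : ∀ i j → G (h i) (h j) ≡ H i j

∘-isEmbedding : ∀ {H : Digraph p} {G : Digraph m} {D : Digraph n} {g f} →
                IsEmbedding G D f → IsEmbedding H G g → IsEmbedding H D (f ∘ g)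
∘-isEmbedding (f-inj , f-arcs) (g-inj , g-arcs) =
  g-inj ∘ f-inj , λ i j → trans (f-arcs _ _) (g-arcs i j)

CopyWhere : Digraph m → Pred (Fin m) 0ℓ → Digraph p → Set
CopyWhere {p = p} G P H = Σ (Fin p → Fin _) λ g → IsEmbedding H G g × (∀ i → P (g i))

copyWhere⊎copyWhere¬ : ∀ {G : Digraph m} {H : Digraph p} →
                       ((X : Subset m) → HasCopyIn G X H ⊎ HasCopyIn G (∁ X) H) →
                       {P : Pred (Fin m) 0ℓ} (P? : Decidable P) →
                       CopyWhere G P H ⊎ CopyWhere G (¬_ ∘ P) H
copyWhere⊎copyWhere¬ split P? with split (decSubset P?)
... | inj₁ (g , g-inj , g∈X , g-arcs) =
  inj₁ (g , (g-inj , g-arcs) , ∈-decSubset⁻ P? ∘ g∈X)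
... | inj₂ (g , g-inj , g∈∁X , g-arcs) =
  inj₂ (g , (g-inj , g-arcs) , λ i → x∈∁p⇒x∉p (g∈∁X i) ∘ ∈-decSubset⁺ P?)

pullbackOrder : (h : Fin p → Fin n) → Injective _≡_ _≡_ h → TotalOrder n → TotalOrder p
pullbackOrder h h-inj (_≺_ , sto) = (λ i j → h i ≺ h j) , record
  { isStrictPartialOrder = record
    { isEquivalence = isEquivalence
    ; irrefl        = irrefl ∘ cong h
    ; trans         = ≺-trans
    ; <-resp-≈      = resp₂ _
    }
  ; compare       = compare-h
  }
  where
  open IsStrictTotalOrder sto using (irrefl; compare) renaming (trans to ≺-trans)
  compare-h : ∀ i j → Tri (h i ≺ h j) (i ≡ j) (h j ≺ h i)
  compare-h i j with compare (h i) (h j)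
  ... | tri< a ¬b ¬c = tri< a (¬b ∘ cong h) ¬c
  ... | tri≈ ¬a b ¬c = tri≈ ¬a (h-inj b) ¬c
  ... | tri> ¬a ¬b c = tri> ¬a (¬b ∘ cong h) c

≺⊎⪰ : ∀ {_≺_ : Rel (Fin n) 0ℓ} → IsStrictTotalOrder _≡_ _≺_ →
      ∀ x y → x ≺ y ⊎ StrictToNonStrict._≤_ _≡_ _≺_ y x
≺⊎⪰ sto x y with IsStrictTotalOrder.compare sto x y
... | tri< x≺y _ _ = inj₁ x≺y
... | tri≈ _ x≡y _ = inj₂ (inj₂ (sym x≡y))
... | tri> _ _ y≺x = inj₂ (inj₁ y≺x)

ωBack≤⇒¬ωBack≥suc : ∀ {D : Digraph n} {_≺_ k} → ωBack≤ D _≺_ k → ¬ ωBack≥ D _≺_ (suc k)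
ωBack≤⇒¬ωBack≥suc ω≤ (S , S-clique , k<∣S∣) = 1+n≰n (≤-trans k<∣S∣ (ω≤ S S-clique))

module _ {n} (D : Digraph n) {_≺_ : Rel (Fin n) 0ℓ} (sto : IsStrictTotalOrder _≡_ _≺_) where
  open IsStrictTotalOrder sto using (irrefl; asym; compare; <-respˡ-≈) renaming (trans to ≺-trans)
  open StrictToNonStrict _≡_ _≺_ using (≤-<-trans) renaming (_≤_ to _⪯_)

  BackEdge : Rel (Fin n) 0ℓ
  BackEdge x y = (x ≺ y × arc D y x) ⊎ (y ≺ x × arc D x y)

  backEdge-irrefl : ∀ {x y} → BackEdge x y → x ≢ y
  backEdge-irrefl (inj₁ (x≺y , _)) refl = irrefl refl x≺y
  backEdge-irrefl (inj₂ (y≺x , _)) refl = irrefl refl y≺x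

  backEdge⇒arc : ∀ {x y} → BackEdge x y → x ≺ y → arc D y x
  backEdge⇒arc (inj₁ (_ , yx))   _   = yx
  backEdge⇒arc (inj₂ (y≺x , _)) x≺y = ⊥-elim (asym x≺y y≺x)

  cone-ωBack≥ : ∀ {p k} {H : Digraph p} {h : Fin p → Fin n} → IsEmbedding H D h →
                ((o : TotalOrder p) → ωBack≥ H (proj₁ o) k) →
                (z : Fin n) → (∀ i → BackEdge z (h i)) → ωBack≥ D _≺_ (suc k)
  cone-ωBack≥ {h = h} (h-inj , h-arcs) ω≥ z z~h
    with ω≥ (pullbackOrder h h-inj (_ , sto))
  ... | S , S-clique , k≤∣S∣ =
    image (z ◂ h) (inside ∷ S) , clique ,
    ≤-trans (s≤s k≤∣S∣) (∣p∣≤∣image∣ (◂-injective (backEdge-irrefl ∘ z~h) h-inj) (inside ∷ S))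
    where
    clique : IsBackClique D _≺_ (image (z ◂ h) (inside ∷ S))
    clique x y x∈ y∈ x≺y with ∈-image⁻ _ _ x∈ | ∈-image⁻ _ _ y∈
    ... | zero  , _         , refl | zero  , _         , refl = ⊥-elim (irrefl refl x≺y)
    ... | zero  , _         , refl | suc j , _         , refl = backEdge⇒arc (z~h j) x≺y
    ... | suc i , _         , refl | zero  , _         , refl = backEdge⇒arc (swap (z~h i)) x≺y
    ... | suc i , there i∈S , refl | suc j , there j∈S , refl =
      subst T (sym (h-arcs j i)) (S-clique i j i∈S j∈S x≺y)

  reversed⇒ωBack≥ : ∀ {m p k} {Tk : Digraph m} {H : Digraph p} → IsTournament Tk →
                    ((o : TotalOrder p) → ωBack≥ H (proj₁ o) k) →
                    ((X : Subset m) → HasCopyIn Tk X H ⊎ HasCopyIn Tk (∁ X) H) →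
                    ∀ {u v} {f : Fin m → Fin n} → IsEmbedding Tk D f →
                    (∀ i → arc D u (f i) × arc D (f i) v) →
                    v ⪯ u → ωBack≥ D _≺_ (suc k)
  reversed⇒ωBack≥ tour ω≥ split {u} {v} {f} f-emb@(_ , f-arcs) adj v⪯u
    with copyWhere⊎copyWhere¬ split (λ i → IsStrictTotalOrder._<?_ sto (f i) u)
  ... | inj₁ (g , g-emb , before) =
    cone-ωBack≥ (∘-isEmbedding f-emb g-emb) ω≥ u λ i → inj₂ (before i , proj₁ (adj (g i)))
  ... | inj₂ (g , g-emb , notBefore) =
    cone-ωBack≥ (∘-isEmbedding f-emb g-emb) ω≥ v λ i → inj₁ (after-v (g i) (notBefore i) , proj₂ (adj (g i)))
    where
    f≢u : ∀ i → f i ≢ u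
    f≢u i refl = IsTournament.loopless tour i (subst T (f-arcs i i) (proj₁ (adj i)))
    after-v : ∀ i → ¬ f i ≺ u → v ≺ f i
    after-v i ¬fi≺u with compare (f i) u
    ... | tri< fi≺u _ _ = ⊥-elim (¬fi≺u fi≺u)
    ... | tri≈ _ fi≡u _ = ⊥-elim (f≢u i fi≡u)
    ... | tri> _ _ u≺fi = ≤-<-trans sym ≺-trans <-respˡ-≈ v⪯u u≺fi

lemma3p5 : (k : ℕ) → 1 ≤ k
    → (m : ℕ) (Tk : Digraph m) → IsTournament Tk → ω⃗≡ Tk k
    → (Σ ℕ λ p → Σ (Digraph p) λ T → IsTournament T × ω⃗≡ T k
         × ((X : Subset m) → HasCopyIn Tk X T ⊎ HasCopyIn Tk (∁ X) T))
    → (n : ℕ) (D : Digraph n) (u v : Fin n)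
    → (f : Fin m → Fin n) → Injective _≡_ _≡_ f
    → (∀ i → arc D u (f i) × arc D (f i) v)
    → (∀ i j → D (f i) (f j) ≡ Tk i j)
    → (o : TotalOrder n) → ωBack≤ D (proj₁ o) k
    → proj₁ o u v
lemma3p5 k _ m Tk tour _ (p , H , _ , (_ , ω≥) , split) n D u v f f-inj adj f-arcs (_≺_ , sto) ω≤
  with ≺⊎⪰ sto u v
... | inj₁ u≺v = u≺v
... | inj₂ v⪯u =
  ⊥-elim (ωBack≤⇒¬ωBack≥suc ω≤ (reversed⇒ωBack≥ D sto tour ω≥ split (f-inj , f-arcs) adj v⪯u))
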